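{- Let $F$ be a CNF formula, $l$ a literal such that $\neg l$ does not occur in $F$, $c \in F$ a clause with $l \notin c$, and $c'$ a clause with $l \in c'$. Then $c$ is superredundant in $F$ if and only if $c$ is superredundant in $F \setminus \{c'\}$.
   Context: A CNF formula is a finite set of clauses; a clause is a finite set of literals, read as their disjunction. Tautological clauses are not allowed. Resolution: from clauses $c_1 \vee l$ and $c_2 \vee \neg l$ derive $c_1 \vee c_2$; two clauses whose resolvent would be a tautology are considered not to resolve. The resolution closure $\mathrm{ResCn}(F)$ is the set of all clauses obtainable from $F$ by zero or more resolution steps. A clause $c \in F$ is superredundant in $F$ if $\mathrm{ResCn}(F) \setminus \{c\} \models c$. -}

module Defs where

open import Data.Nat using (ℕ)
open import Data.Bool using (Bool; true; false; not)
open import Data.List using (List)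
open import Data.List.Membership.Propositional using (_∈_; _∉_)
open import Data.List.Relation.Unary.Any using (Any)
open import Data.Product using (_×_; ∃; ∃-syntax)
open import Data.Sum using (_⊎_)
open import Relation.Nullary using (¬_)
open import Relation.Binary.PropositionalEquality using (_≡_; _≢_)

data Lit : Set where
  pos : ℕ → Lit
  neg : ℕ → Lit

¬ₗ_ : Lit → Lit
¬ₗ pos x = neg x
¬ₗ neg x = pos x

-- A clause is a finite set of literals, represented by a list read as a set
-- (only membership matters).
Clause : Set
Clause = List Lit

_≈_ : Clause → Clause → Set
c ≈ d = (∀ x → x ∈ c → x ∈ d) × (∀ x → x ∈ d → x ∈ c)

Tautology : Clause → Set
Tautology c = ∃[ x ] (x ∈ c × (¬ₗ x) ∈ c)

-- A CNF formula is a finite set of clauses, represented as a list read as a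
-- set of clauses (membership up to clause equality ≈).
CNF : Set
CNF = List Clause

ClauseSet : Set₁
ClauseSet = Clause → Set

⟦_⟧ : CNF → ClauseSet
⟦ F ⟧ d = Any (d ≈_) F

_∖｛_｝ : ClauseSet → Clause → ClauseSet
(S ∖｛ c ｝) d = S d × ¬ (d ≈ c)

Resolvent : Clause → Clause → Lit → Clause → Set
Resolvent a b l d =
  l ∈ a × (¬ₗ l) ∈ b × ¬ Tautology d ×
  (∀ x → x ∈ d → (x ∈ a × x ≢ l) ⊎ (x ∈ b × x ≢ ¬ₗ l)) ×
  (∀ x → (x ∈ a × x ≢ l) ⊎ (x ∈ b × x ≢ ¬ₗ l) → x ∈ d)

data ResCn (S : ClauseSet) : ClauseSet where
  base : ∀ {d} → S d → ResCn S d
  res  : ∀ {a b d} (l : Lit) → ResCn S a → ResCn S b → Resolvent a b l d → ResCn S d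

Assignment : Set
Assignment = ℕ → Bool

evalLit : Assignment → Lit → Bool
evalLit σ (pos x) = σ x
evalLit σ (neg x) = not (σ x)

SatClause : Assignment → Clause → Set
SatClause σ c = ∃[ x ] (x ∈ c × evalLit σ x ≡ true)

_⊨_ : ClauseSet → Clause → Set
S ⊨ c = ∀ (σ : Assignment) → (∀ d → S d → SatClause σ d) → SatClause σ c

Superredundant : Clause → ClauseSet → Set
Superredundant c S = S c × ((ResCn S ∖｛ c ｝) ⊨ c)

WellFormed : CNF → Set
WellFormed F = ∀ d → ⟦ F ⟧ d → ¬ Tautology d

-- A clause containing the pure literal l can take part in a resolution step only on a
-- pivot other than l, so l survives into the resolvent: a derivation of a clause without l
-- never touches clauses with l, in particular not c′. Hence ResCn(F) ∖ {c} and
-- ResCn(F ∖ {c′}) ∖ {c} differ only by clauses containing l, and these are satisfied by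
-- any assignment after l is made true; since c mentions neither l nor ¬l, doing so does not
-- change the truth value of c.
module Submission where

open import Defs
open import Data.Bool using (Bool; true; false; not)
open import Data.Empty using (⊥-elim)
open import Data.List.Membership.Propositional using (_∈_; _∉_)
open import Data.Nat using (ℕ)
open import Data.Nat.Properties using (_≟_)
open import Data.Product using (_×_; _,_; proj₁; proj₂)
open import Data.Sum as Sum using (_⊎_; inj₁; inj₂; [_,_])
open import Function.Bundles using (_⇔_; mk⇔; module Equivalence)
open import Relation.Binary.Definitions using (DecidableEquality)
open import Relation.Binary.PropositionalEquality
  using (_≡_; _≢_; refl; sym; trans; cong; subst)
open import Relation.Nullary using (¬_; yes; no)
open import Relation.Nullary.Decidable using (map′)

¬ₗ-involutive : ∀ x → ¬ₗ (¬ₗ x) ≡ x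
¬ₗ-involutive (pos _) = refl
¬ₗ-involutive (neg _) = refl

_≟ₗ_ : DecidableEquality Lit
pos x ≟ₗ pos y = map′ (cong pos) (λ { refl → refl }) (x ≟ y)
neg x ≟ₗ neg y = map′ (cong neg) (λ { refl → refl }) (x ≟ y)
pos _ ≟ₗ neg _ = no λ ()
neg _ ≟ₗ pos _ = no λ ()

open import Data.List.Membership.DecPropositional _≟ₗ_ using (_∈?_)

module _ {a b p d} (r : Resolvent a b p d) where

  Resolvent-⊆ : ∀ {x} → x ∈ d → x ∈ a ⊎ x ∈ b
  Resolvent-⊆ x∈d = let (_ , _ , _ , d⊆ , _) = r in Sum.map proj₁ proj₁ (d⊆ _ x∈d)

  Resolvent-keepsˡ : ∀ {x} → x ∈ a → x ≢ p → x ∈ d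
  Resolvent-keepsˡ x∈a x≢p = let (_ , _ , _ , _ , ⊆d) = r in ⊆d _ (inj₁ (x∈a , x≢p))

  Resolvent-keepsʳ : ∀ {x} → x ∈ b → x ≢ ¬ₗ p → x ∈ d
  Resolvent-keepsʳ x∈b x≢¬p = let (_ , _ , _ , _ , ⊆d) = r in ⊆d _ (inj₂ (x∈b , x≢¬p))

ResCn-mono : ∀ {S T : ClauseSet} → (∀ {d} → S d → T d) → ∀ {d} → ResCn S d → ResCn T d
ResCn-mono S⊆T (base d∈S)      = base (S⊆T d∈S)
ResCn-mono S⊆T (res p ra rb r) = res p (ResCn-mono S⊆T ra) (ResCn-mono S⊆T rb) r

⊨-mono : ∀ {S T : ClauseSet} {c} → (∀ {d} → S d → T d) → S ⊨ c → T ⊨ c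
⊨-mono S⊆T S⊨c σ σ⊨T = S⊨c σ (λ d d∈S → σ⊨T d (S⊆T d∈S))

module _ {S : ClauseSet} where

  ∉-ResCn : ∀ {x} → (∀ d → S d → x ∉ d) → ∀ {d} → ResCn S d → x ∉ d
  ∉-ResCn x∉S (base d∈S)      = x∉S _ d∈S
  ∉-ResCn x∉S (res _ ra rb r) x∈d =
    [ ∉-ResCn x∉S ra , ∉-ResCn x∉S rb ] (Resolvent-⊆ r x∈d)

  ResCn-pure-avoiding : ∀ {l} → (∀ d → S d → ¬ₗ l ∉ d) →
                        ∀ {d} → ResCn S d → l ∉ d → ResCn (λ e → S e × l ∉ e) d
  ResCn-pure-avoiding ¬l∉S (base d∈S)      l∉d = base (d∈S , l∉d)
  ResCn-pure-avoiding {l} ¬l∉S (res p ra rb r@(p∈a , ¬p∈b , _)) l∉d =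
    res p (ResCn-pure-avoiding ¬l∉S ra l∉a) (ResCn-pure-avoiding ¬l∉S rb l∉b) r
    where
    l∉a : l ∉ _
    l∉a l∈a = l∉d (Resolvent-keepsˡ r l∈a λ { refl → ∉-ResCn ¬l∉S rb ¬p∈b })
    l∉b : l ∉ _
    l∉b l∈b = l∉d (Resolvent-keepsʳ r l∈b λ { refl →
      ∉-ResCn ¬l∉S ra (subst (_∈ _) (sym (¬ₗ-involutive p)) p∈a) })

var : Lit → ℕ
var (pos x) = x
var (neg x) = x

sign : Lit → Bool
sign (pos _) = true
sign (neg _) = false

var-≡ : ∀ x l → var x ≡ var l → x ≡ l ⊎ x ≡ ¬ₗ l
var-≡ (pos _) (pos _) refl = inj₁ refl
var-≡ (pos _) (neg _) refl = inj₂ refl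
var-≡ (neg _) (pos _) refl = inj₂ refl
var-≡ (neg _) (neg _) refl = inj₁ refl

_[_≔true] : Assignment → Lit → Assignment
(σ [ l ≔true]) y with y ≟ var l
... | yes _ = sign l
... | no  _ = σ y

≔true-var : ∀ σ l → (σ [ l ≔true]) (var l) ≡ sign l
≔true-var σ l with var l ≟ var l
... | yes _ = refl
... | no  v≢v = ⊥-elim (v≢v refl)

≔true-other : ∀ σ l {y} → y ≢ var l → (σ [ l ≔true]) y ≡ σ y
≔true-other σ l {y} y≢v with y ≟ var l
... | yes y≡v = ⊥-elim (y≢v y≡v)
... | no  _   = refl

evalLit-≔true-self : ∀ σ l → evalLit (σ [ l ≔true]) l ≡ true
evalLit-≔true-self σ (pos v) = ≔true-var σ (pos v)
evalLit-≔true-self σ (neg v) = cong not (≔true-var σ (neg v))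

evalLit-≔true-other : ∀ σ l {x} → x ≢ l → x ≢ ¬ₗ l → evalLit (σ [ l ≔true]) x ≡ evalLit σ x
evalLit-≔true-other σ l {pos y} x≢l x≢¬l = ≔true-other σ l λ e → [ x≢l , x≢¬l ] (var-≡ (pos y) l e)
evalLit-≔true-other σ l {neg y} x≢l x≢¬l =
  cong not (≔true-other σ l λ e → [ x≢l , x≢¬l ] (var-≡ (neg y) l e))

SatClause-≔true : ∀ σ l {d} → l ∉ d → ¬ₗ l ∉ d → SatClause (σ [ l ≔true]) d ⇔ SatClause σ d
SatClause-≔true σ l {d} l∉d ¬l∉d = mk⇔
  (λ (x , x∈d , ev) → x , x∈d , trans (sym (unchanged x x∈d)) ev)
  (λ (x , x∈d , ev) → x , x∈d , trans (unchanged x x∈d) ev)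
  where
  unchanged : ∀ x → x ∈ d → evalLit (σ [ l ≔true]) x ≡ evalLit σ x
  unchanged x x∈d = evalLit-≔true-other σ l {x} (λ { refl → l∉d x∈d }) (λ { refl → ¬l∉d x∈d })

≔true-satisfies-ResCn : ∀ {S l c σ} → (∀ d → S d → ¬ₗ l ∉ d) →
                        (∀ d → (ResCn (λ e → S e × l ∉ e) ∖｛ c ｝) d → SatClause σ d) →
                        ∀ d → (ResCn S ∖｛ c ｝) d → SatClause (σ [ l ≔true]) d
≔true-satisfies-ResCn {l = l} {σ = σ} ¬l∉S σ⊨S⁻ d (d∈S , d≉c) with l ∈? d
... | yes l∈d = l , l∈d , evalLit-≔true-self σ l
... | no  l∉d = Equivalence.from (SatClause-≔true σ l l∉d (∉-ResCn ¬l∉S d∈S))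
                  (σ⊨S⁻ d (ResCn-pure-avoiding ¬l∉S d∈S l∉d , d≉c))

lemma10 : (F : CNF) (l : Lit) (c c′ : Clause) →
          WellFormed F →
          ¬ Tautology c′ →
          (∀ d → ⟦ F ⟧ d → (¬ₗ l) ∉ d) →
          ⟦ F ⟧ c →
          l ∉ c →
          l ∈ c′ →
          Superredundant c ⟦ F ⟧ ⇔ Superredundant c (⟦ F ⟧ ∖｛ c′ ｝)
lemma10 F l c c′ _ _ ¬l∉F c∈F l∉c l∈c′ = mk⇔ to from
  where
  ≉c′ : ∀ {d} → l ∉ d → ¬ (d ≈ c′)
  ≉c′ l∉d d≈c′ = l∉d (proj₂ d≈c′ l l∈c′)

  to : Superredundant c ⟦ F ⟧ → Superredundant c (⟦ F ⟧ ∖｛ c′ ｝)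
  to (_ , F⊨c) = (c∈F , ≉c′ l∉c) , λ σ σ⊨F′ →
    Equivalence.to (SatClause-≔true σ l l∉c (¬l∉F c c∈F))
      (F⊨c (σ [ l ≔true]) (≔true-satisfies-ResCn ¬l∉F λ d (d∈F⁻ , d≉c) →
        σ⊨F′ d (ResCn-mono (λ (e∈F , l∉e) → e∈F , ≉c′ l∉e) d∈F⁻ , d≉c)))

  from : Superredundant c (⟦ F ⟧ ∖｛ c′ ｝) → Superredundant c ⟦ F ⟧
  from (_ , F′⊨c) = c∈F , ⊨-mono (λ (d∈F′ , d≉c) → ResCn-mono proj₁ d∈F′ , d≉c) F′⊨c
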